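{- Let $\Sigma=\{A,C,G,T\}$, $\ell\ge1$, and let $\mathcal{C}$ be an $(n,k)$ code, i.e. an injective encoding map $(\Sigma^\ell)^k\to(\Sigma^\ell)^n$, $\mathcal{U}=(\mathbf{u}_1,\ldots,\mathbf{u}_k)\mapsto\mathcal{X}=(\mathbf{x}_1,\ldots,\mathbf{x}_n)$. For $i\in[k]$, a set $J\subseteq[n]$ is a retrieval set of $\mathbf{u}_i$ if there is a function $g$ with $\mathbf{u}_i=g((\mathbf{x}_j)_{j\in J})$ for every $\mathcal{U}\in(\Sigma^\ell)^k$; let $\mathcal{D}(i)$ be the set of inclusion-minimal retrieval sets of $\mathbf{u}_i$. Indices in $[n]$ are drawn independently and uniformly at random with replacement, and $\tau_i(\mathcal{C})$ is the smallest $r$ such that the set of indices drawn in the first $r$ draws is a retrieval set of $\mathbf{u}_i$. If $\mathcal{D}(i)=\{A,B\}$ with $A\cap B=\emptyset$, then $$\mathbb{E}[\tau_i(\mathcal{C})]=n\big(H_{|A|}+H_{|B|}-H_{|A|+|B|}\big),$$ where $H_m=\sum_{j=1}^m\frac1j$. -}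

module Defs where

open import Data.Nat as ℕ using (ℕ; zero; suc; _^_; NonZero; _<_)
open import Data.Nat.Properties using (m^n≢0)
open import Data.Fin using (Fin; toℕ)
open import Data.Fin.Subset using (Subset; _∈_; _⊆_; _∪_; ⁅_⁆) renaming (⊥ to ∅)
open import Data.Fin.Properties using (all?)
open import Data.Vec using (Vec)
open import Data.List using (List; []; _∷_; [_]; map; concatMap; allFin; take; length; filter)
open import Data.Product using (Σ; _×_)
open import Data.Integer using (+_)
open import Data.Rational using (ℚ; 0ℚ; _+_; _*_; _/_)
open import Relation.Binary.PropositionalEquality using (_≡_)
open import Relation.Nullary using (¬_; Dec)
open import Relation.Nullary.Decidable using (_×-dec_; ¬?)

Σ₄ : Set
Σ₄ = Fin 4

Word : ℕ → Set
Word ℓ = Vec Σ₄ ℓ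

Encoder : ℕ → ℕ → ℕ → Set
Encoder ℓ k n = (Fin k → Word ℓ) → (Fin n → Word ℓ)

InjectiveCode : ∀ {ℓ k n} → Encoder ℓ k n → Set
InjectiveCode {k = k} {n = n} enc =
  ∀ U U' → (∀ (j : Fin n) → enc U j ≡ enc U' j) → ∀ (i : Fin k) → U i ≡ U' i

IsRetrievalSet : ∀ {ℓ k n} → Encoder ℓ k n → Fin k → Subset n → Set
IsRetrievalSet {ℓ} {k} {n} enc i J =
  Σ (((j : Fin n) → j ∈ J → Word ℓ) → Word ℓ) λ g →
    ∀ (U : Fin k → Word ℓ) → U i ≡ g (λ j _ → enc U j)

IsMinimalRetrievalSet : ∀ {ℓ k n} → Encoder ℓ k n → Fin k → Subset n → Set
IsMinimalRetrievalSet {n = n} enc i J =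
  IsRetrievalSet enc i J ×
  (∀ (J' : Subset n) → J' ⊆ J → IsRetrievalSet enc i J' → J ⊆ J')

drawnSet : ∀ {n} → List (Fin n) → Subset n
drawnSet []       = ∅
drawnSet (j ∷ js) = ⁅ j ⁆ ∪ drawnSet js

-- All sequences of r draws from [n] (head = first draw), each exactly once.
allDraws : ∀ n → ℕ → List (List (Fin n))
allDraws n zero    = [ [] ]
allDraws n (suc r) = concatMap (λ j → map (j ∷_) (allDraws n r)) (allFin n)

StopsExactlyAt : ∀ {ℓ k n} → Encoder ℓ k n → Fin k → (r : ℕ) → List (Fin n) → Set
StopsExactlyAt enc i r xs =
  IsRetrievalSet enc i (drawnSet (take r xs)) ×
  (∀ (m : Fin r) → ¬ IsRetrievalSet enc i (drawnSet (take (toℕ m) xs)))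

stopsExactlyAt? : ∀ {ℓ k n} (enc : Encoder ℓ k n) (i : Fin k) →
  (∀ J → Dec (IsRetrievalSet enc i J)) →
  (r : ℕ) (xs : List (Fin n)) → Dec (StopsExactlyAt enc i r xs)
stopsExactlyAt? enc i dec r xs =
  dec (drawnSet (take r xs)) ×-dec all? (λ m → ¬? (dec (drawnSet (take (toℕ m) xs))))

probStop : ∀ {ℓ k n} .{{_ : NonZero n}} (enc : Encoder ℓ k n) (i : Fin k) →
  (∀ J → Dec (IsRetrievalSet enc i J)) → ℕ → ℚ
probStop {n = n} enc i dec r =
  _/_ (+ length (filter (stopsExactlyAt? enc i dec r) (allDraws n r))) (n ^ r)
      {{m^n≢0 n r}}

expectationPartial : ∀ {ℓ k n} .{{_ : NonZero n}} (enc : Encoder ℓ k n) (i : Fin k) →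
  (∀ J → Dec (IsRetrievalSet enc i J)) → ℕ → ℚ
expectationPartial enc i dec zero    = 0ℚ
expectationPartial enc i dec (suc N) =
  expectationPartial enc i dec N + (+ suc N / 1) * probStop enc i dec (suc N)

H : ℕ → ℚ
H zero    = 0ℚ
H (suc m) = H m + (+ 1 / suc m)

{-# OPTIONS --safe #-}
module Submission where

-- Every retrieval set of u_i contains a minimal one, so the retrieval sets are exactly the
-- supersets of A or of B. Hence all that matters about the indices D drawn so far is the
-- profile (a , b , c): the numbers of undrawn elements of A and of B, and of the c = n - a - b
-- other positions. Conditioning on the first draw gives a recursion over profiles for the
-- number of draw sequences that stop exactly at draw r, and so first-step recursions for the
-- survival T_M = Pr[τ > M] and for the error E_M = n (H_a + H_b - H_(a+b)) - Σ_{r ≤ M} r Pr[τ = r];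
-- the candidate limit passes the first-step test because of the harmonic identity
-- (a + b) h(a, b) = a h(a - 1, b) + b h(a, b - 1) + 1 for h(a, b) = H_a + H_b - H_(a+b).
-- One draw turns a bound a K on a profile's neighbours into a K (n - 1) / n, so by induction
-- |T_M| ≤ a ((n-1)/n)^M and |E_M| ≤ a (M + n) ((n-1)/n)^M, which tends to 0.

open import Defs

module Combinatorics where

  open import Data.Bool using (Bool; true; false; _∧_)
  open import Data.Empty using (⊥-elim)
  open import Data.Fin using (Fin; zero; suc; toℕ)
  open import Data.Fin.Properties using (any?; all?)
  open import Data.Fin.Subset using (Subset; _∈_; _⊆_; _∪_; _∩_; _-_; ⁅_⁆; ⊥; ∣_∣)
  open import Data.Fin.Subset.Properties
    using (_∈?_; ∪-identityˡ; ∪-identityʳ; ∪-assoc; ⊆-refl; ⊆-trans; drop-∷-⊆; x∈p∧x≢y⇒x∈p-y; p─q⊆p; x∈p⇒∣p-x∣<∣p∣)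
  open import Data.List using (List; []; _∷_; _++_; map; concatMap; length; filter; tabulate; take)
  open import Data.List.Properties using (filter-++; length-++; filter-≐; filter-none; filter-accept; filter-reject)
  import Data.List.Relation.Unary.All as All
  open import Data.Nat using (ℕ; zero; suc; pred; _+_; _*_; _<_; s≤s)
  open import Data.Nat.Properties using (+-0-monoid; ≤-refl; <-≤-trans; m+n≡0⇒n≡0; _≟_)
  open import Data.Nat.Solver using (module +-*-Solver)
  open import Data.Product using (∃-syntax; _×_; _,_; proj₁)
  open import Data.Sum using (_⊎_; inj₁; inj₂)
  open import Data.Vec using ([]; _∷_; here; there; head; tail)
  open import Function using (_∘_; id)
  open import Function.Bundles using (_⇔_; mk⇔; Equivalence)
  open import Function.Properties.Equivalence using () renaming (trans to ⇔-trans; sym to ⇔-sym)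
  open import Data.Sum.Function.Propositional using (_⊎-⇔_)
  open import Relation.Binary.PropositionalEquality
    using (_≡_; refl; sym; trans; cong; cong₂; subst; module ≡-Reasoning)
  open import Relation.Nullary using (Dec; yes; no; ¬_)
  open import Relation.Nullary.Decidable using (_×-dec_; _⊎-dec_; ¬?)
  open import Level using (0ℓ)
  open import Relation.Unary using (Pred; Decidable; _≐_)

  open import Algebra.Properties.Monoid.Sum +-0-monoid using (sum; sum-cong-≗; sum-replicate-zero)

  -- Retrieval sets

  module RetrievalSets {ℓ k n} (enc : Encoder ℓ k n) (i : Fin k)
                       (retrieves? : ∀ J → Dec (IsRetrievalSet enc i J)) where

    Retrieves : Subset n → Set
    Retrieves = IsRetrievalSet enc i

    retrieves-⊆ : ∀ {J J′} → J ⊆ J′ → Retrieves J → Retrieves J′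
    retrieves-⊆ J⊆J′ (g , spec) = (λ x → g (λ j j∈J → x j (J⊆J′ j∈J))) , spec

    -- Drop an element whenever the rest still retrieves; the recursion is on ∣ J ∣.
    minimal-⊆ : ∀ J → Retrieves J → ∃[ S ] S ⊆ J × IsMinimalRetrievalSet enc i S
    minimal-⊆ J = go (suc ∣ J ∣) J ≤-refl
      where
      go : ∀ m J → ∣ J ∣ < m → Retrieves J → ∃[ S ] S ⊆ J × IsMinimalRetrievalSet enc i S
      go (suc m) J (s≤s ∣J∣≤m) rJ with any? (λ x → x ∈? J ×-dec retrieves? (J - x))
      ... | yes (x , x∈J , rJ-x) =
        let S , S⊆J-x , minS = go m (J - x) (<-≤-trans (x∈p⇒∣p-x∣<∣p∣ x∈J) ∣J∣≤m) rJ-x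
        in S , ⊆-trans S⊆J-x (p─q⊆p J ⁅ x ⁆) , minS
      ... | no irredundant = J , ⊆-refl , rJ , minimal
        where
        minimal : ∀ J′ → J′ ⊆ J → Retrieves J′ → J ⊆ J′
        minimal J′ J′⊆J rJ′ {x} x∈J with x ∈? J′
        ... | yes x∈J′ = x∈J′
        ... | no x∉J′ = ⊥-elim (irredundant (x , x∈J , retrieves-⊆ J′⊆J-x rJ′))
          where
          J′⊆J-x : J′ ⊆ J - x
          J′⊆J-x y∈J′ = x∈p∧x≢y⇒x∈p-y (J′⊆J y∈J′) λ { refl → x∉J′ y∈J′ }

    retrieves⇔ : ∀ {A B} → (∀ J → IsMinimalRetrievalSet enc i J ⇔ (J ≡ A ⊎ J ≡ B)) →
                 ∀ J → Retrieves J ⇔ (A ⊆ J ⊎ B ⊆ J)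
    retrieves⇔ {A} {B} minimal⇔ J = mk⇔ to from
      where
      to : Retrieves J → A ⊆ J ⊎ B ⊆ J
      to rJ with minimal-⊆ J rJ
      ... | S , S⊆J , minS with Equivalence.to (minimal⇔ S) minS
      ... | inj₁ refl = inj₁ S⊆J
      ... | inj₂ refl = inj₂ S⊆J
      from : A ⊆ J ⊎ B ⊆ J → Retrieves J
      from (inj₁ A⊆J) = retrieves-⊆ A⊆J (proj₁ (Equivalence.from (minimal⇔ A) (inj₁ refl)))
      from (inj₂ B⊆J) = retrieves-⊆ B⊆J (proj₁ (Equivalence.from (minimal⇔ B) (inj₂ refl)))

  -- Profile of a drawn set

  unseenAt : Bool → Bool → ℕ
  unseenAt _     true  = 0
  unseenAt true  false = 1
  unseenAt false false = 0

  -- A position is settled when it is drawn or outside A ∪ B.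
  settledAt : Bool → Bool → Bool → ℕ
  settledAt _     _     true  = 1
  settledAt false false false = 1
  settledAt true  _     false = 0
  settledAt false true  false = 0

  unseen : ∀ {n} → Subset n → Subset n → ℕ
  unseen []      []      = 0
  unseen (a ∷ A) (d ∷ D) = unseenAt a d + unseen A D

  settled : ∀ {n} → Subset n → Subset n → Subset n → ℕ
  settled []      []      []      = 0
  settled (a ∷ A) (b ∷ B) (d ∷ D) = settledAt a b d + settled A B D

  atProfile : ∀ {n} {X : Set} → Subset n → Subset n → (ℕ → ℕ → ℕ → X) → Subset n → X
  atProfile A B G D = G (unseen A D) (unseen B D) (settled A B D)

  unseen-⊥ : ∀ {n} (A : Subset n) → unseen A ⊥ ≡ ∣ A ∣
  unseen-⊥ []          = refl
  unseen-⊥ (true ∷ A)  = cong suc (unseen-⊥ A)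
  unseen-⊥ (false ∷ A) = unseen-⊥ A

  unseen≡0⇔⊆ : ∀ {n} (A D : Subset n) → unseen A D ≡ 0 ⇔ A ⊆ D
  unseen≡0⇔⊆ A D = mk⇔ (to A D) (from A D)
    where
    to : ∀ {n} (A D : Subset n) → unseen A D ≡ 0 → A ⊆ D
    to (true ∷ A)  (true ∷ D)  _  here      = here
    to (a ∷ A)     (d ∷ D)     eq (there x) = there (to A D (m+n≡0⇒n≡0 (unseenAt a d) eq) x)
    from : ∀ {n} (A D : Subset n) → A ⊆ D → unseen A D ≡ 0
    from []          []          _   = refl
    from (a ∷ A)     (true ∷ D)  A⊆D = from A D (drop-∷-⊆ A⊆D)
    from (false ∷ A) (false ∷ D) A⊆D = from A D (drop-∷-⊆ A⊆D)
    from (true ∷ A)  (false ∷ D) A⊆D with A⊆D here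
    ... | ()

  profile-total : ∀ {n} (A B D : Subset n) → A ∩ B ≡ ⊥ → unseen A D + unseen B D + settled A B D ≡ n
  profile-total []      []      []      _    = refl
  profile-total (a ∷ A) (b ∷ B) (d ∷ D) disj =
    trans (regroup (unseenAt a d) (unseenAt b d) (settledAt a b d) (unseen A D) (unseen B D) (settled A B D))
          (cong₂ _+_ (position a b d (cong head disj)) (profile-total A B D (cong tail disj)))
    where
    open +-*-Solver
    regroup : ∀ x y z X Y Z → x + X + (y + Y) + (z + Z) ≡ (x + y + z) + (X + Y + Z)
    regroup = solve 6 (λ x y z X Y Z → x :+ X :+ (y :+ Y) :+ (z :+ Z) := (x :+ y :+ z) :+ (X :+ Y :+ Z)) refl
    position : ∀ a b d → a ∧ b ≡ false → unseenAt a d + unseenAt b d + settledAt a b d ≡ 1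
    position true  true  _     ()
    position true  false true  _ = refl
    position true  false false _ = refl
    position false true  true  _ = refl
    position false true  false _ = refl
    position false false true  _ = refl
    position false false false _ = refl

  initialProfile-total : ∀ {n} (A B : Subset n) → A ∩ B ≡ ⊥ → ∣ A ∣ + ∣ B ∣ + settled A B ⊥ ≡ n
  initialProfile-total {n} A B A∩B≡⊥ =
    subst (_≡ n) (cong₂ (λ a b → a + b + settled A B ⊥) (unseen-⊥ A) (unseen-⊥ B)) (profile-total A B ⊥ A∩B≡⊥)

  -- n times the expected value of G after one more uniform draw from profile (a , b , c).
  oneDraw : (ℕ → ℕ → ℕ → ℕ) → ℕ → ℕ → ℕ → ℕ
  oneDraw G a b c = a * G (pred a) b (suc c) + b * G a (pred b) (suc c) + c * G a b c

  module _ where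
    open +-*-Solver

    oneDraw-settled : ∀ G a b c →
      G a b (suc c) + oneDraw (λ x y z → G x y (suc z)) a b c ≡ oneDraw G a b (suc c)
    oneDraw-settled G a b c =
      solve 6 (λ x p q a b c → x :+ (a :* p :+ b :* q :+ c :* x) := a :* p :+ b :* q :+ (x :+ c :* x)) refl
        (G a b (suc c)) (G (pred a) b (suc (suc c))) (G a (pred b) (suc (suc c))) a b c

    oneDraw-unseenˡ : ∀ G a b c →
      G a b (suc c) + oneDraw (λ x y z → G (suc x) y z) a b c ≡ oneDraw G (suc a) b c
    oneDraw-unseenˡ G zero b c =
      solve 3 (λ x q r → x :+ (con 0 :+ q :+ r) := (x :+ con 0) :+ q :+ r) refl
        (G zero b (suc c)) (b * G (suc zero) (pred b) (suc c)) (c * G (suc zero) b c)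
    oneDraw-unseenˡ G (suc a) b c =
      solve 4 (λ x a q r → x :+ (a :* x :+ q :+ r) := (x :+ a :* x) :+ q :+ r) refl
        (G (suc a) b (suc c)) (suc a) (b * G (suc (suc a)) (pred b) (suc c)) (c * G (suc (suc a)) b c)

    oneDraw-unseenʳ : ∀ G a b c →
      G a b (suc c) + oneDraw (λ x y z → G x (suc y) z) a b c ≡ oneDraw G a (suc b) c
    oneDraw-unseenʳ G a zero c =
      solve 3 (λ x p r → x :+ (p :+ con 0 :+ r) := p :+ (x :+ con 0) :+ r) refl
        (G a zero (suc c)) (a * G (pred a) (suc zero) (suc c)) (c * G a (suc zero) c)
    oneDraw-unseenʳ G a (suc b) c =
      solve 4 (λ x p b r → x :+ (p :+ b :* x :+ r) := p :+ (x :+ b :* x) :+ r) refl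
        (G a (suc b) (suc c)) (a * G (pred a) (suc (suc b)) (suc c)) (suc b) (c * G a (suc (suc b)) c)

  atProfile-∪⊥ : ∀ {n} {X : Set} (A B : Subset n) (G : ℕ → ℕ → ℕ → X) D → atProfile A B G (D ∪ ⊥) ≡ atProfile A B G D
  atProfile-∪⊥ A B G D = cong (atProfile A B G) (∪-identityʳ D)

  ∑-draw : ∀ {n} (A B D : Subset n) → A ∩ B ≡ ⊥ → (G : ℕ → ℕ → ℕ → ℕ) →
           sum (λ j → atProfile A B G (D ∪ ⁅ j ⁆)) ≡ atProfile A B (oneDraw G) D
  ∑-draw []          []          []          _    G = refl
  ∑-draw (true ∷ A)  (true ∷ B)  (_ ∷ D)     ()   G
  ∑-draw (a ∷ A)     (b ∷ B)     (true ∷ D)  disj G =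
    trans (cong₂ _+_ (atProfile-∪⊥ A B (λ x y z → G x y (suc z)) D) (∑-draw A B D (cong tail disj) (λ x y z → G x y (suc z))))
          (oneDraw-settled G (unseen A D) (unseen B D) (settled A B D))
  ∑-draw (false ∷ A) (false ∷ B) (false ∷ D) disj G =
    trans (cong₂ _+_ (atProfile-∪⊥ A B (λ x y z → G x y (suc z)) D) (∑-draw A B D (cong tail disj) (λ x y z → G x y (suc z))))
          (oneDraw-settled G (unseen A D) (unseen B D) (settled A B D))
  ∑-draw (true ∷ A)  (false ∷ B) (false ∷ D) disj G =
    trans (cong₂ _+_ (atProfile-∪⊥ A B (λ x y z → G x y (suc z)) D) (∑-draw A B D (cong tail disj) (λ x y z → G (suc x) y z)))
          (oneDraw-unseenˡ G (unseen A D) (unseen B D) (settled A B D))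
  ∑-draw (false ∷ A) (true ∷ B)  (false ∷ D) disj G =
    trans (cong₂ _+_ (atProfile-∪⊥ A B (λ x y z → G x y (suc z)) D) (∑-draw A B D (cong tail disj) (λ x y z → G x (suc y) z)))
          (oneDraw-unseenʳ G (unseen A D) (unseen B D) (settled A B D))

  -- Counting stopping sequences

  Done : ℕ → ℕ → Set
  Done a b = a ≡ 0 ⊎ b ≡ 0

  done? : ∀ a b → Dec (Done a b)
  done? a b = (a ≟ 0) ⊎-dec (b ≟ 0)

  -- The number of sequences of r draws that, from profile (a , b , c), complete A or B
  -- for the first time at the r-th draw.
  stopCount : ℕ → ℕ → ℕ → ℕ → ℕ
  stopCount zero    zero    _       _ = 1
  stopCount zero    (suc a) zero    _ = 1
  stopCount zero    (suc a) (suc b) _ = 0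
  stopCount (suc r) zero    _       _ = 0
  stopCount (suc r) (suc a) zero    _ = 0
  stopCount (suc r) (suc a) (suc b) c = oneDraw (stopCount r) (suc a) (suc b) c

  stopCount-zero-done : ∀ {a b} c → Done a b → stopCount zero a b c ≡ 1
  stopCount-zero-done {zero}          _ _          = refl
  stopCount-zero-done {suc _} {zero}  _ _          = refl
  stopCount-zero-done {suc _} {suc _} _ (inj₁ ())
  stopCount-zero-done {suc _} {suc _} _ (inj₂ ())

  stopCount-zero-active : ∀ {a b} c → ¬ Done a b → stopCount zero a b c ≡ 0
  stopCount-zero-active {zero}          _ active = ⊥-elim (active (inj₁ refl))
  stopCount-zero-active {suc _} {zero}  _ active = ⊥-elim (active (inj₂ refl))
  stopCount-zero-active {suc _} {suc _} _ _      = refl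

  stopCount-suc-done : ∀ r {a b} c → Done a b → stopCount (suc r) a b c ≡ 0
  stopCount-suc-done r {zero}          _ _         = refl
  stopCount-suc-done r {suc _} {zero}  _ _         = refl
  stopCount-suc-done r {suc _} {suc _} _ (inj₁ ())
  stopCount-suc-done r {suc _} {suc _} _ (inj₂ ())

  stopCount-suc-active : ∀ r {a b} c → ¬ Done a b → stopCount (suc r) a b c ≡ oneDraw (stopCount r) a b c
  stopCount-suc-active r {zero}          _ active = ⊥-elim (active (inj₁ refl))
  stopCount-suc-active r {suc _} {zero}  _ active = ⊥-elim (active (inj₂ refl))
  stopCount-suc-active r {suc _} {suc _} _ _      = refl

  module _ {A : Set} {P : Pred A 0ℓ} (P? : Decidable P) where

    length-filter-map : ∀ {B : Set} (f : B → A) xs → length (filter P? (map f xs)) ≡ length (filter (P? ∘ f) xs)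
    length-filter-map f []       = refl
    length-filter-map f (x ∷ xs) with P? (f x)
    ... | yes _ = cong suc (length-filter-map f xs)
    ... | no  _ = length-filter-map f xs

    length-filter-concatMap : ∀ {B : Set} {m} (h : B → List A) (f : Fin m → B) →
      length (filter P? (concatMap h (tabulate f))) ≡ sum (λ j → length (filter P? (h (f j))))
    length-filter-concatMap {m = zero}  h f = refl
    length-filter-concatMap {m = suc m} h f = begin
      length (filter P? (h (f zero) ++ concatMap h (tabulate (f ∘ suc))))
        ≡⟨ cong length (filter-++ P? (h (f zero)) _) ⟩
      length (filter P? (h (f zero)) ++ filter P? (concatMap h (tabulate (f ∘ suc))))
        ≡⟨ length-++ (filter P? (h (f zero))) ⟩
      length (filter P? (h (f zero))) + length (filter P? (concatMap h (tabulate (f ∘ suc))))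
        ≡⟨ cong (length (filter P? (h (f zero))) +_) (length-filter-concatMap h (f ∘ suc)) ⟩
      sum (λ j → length (filter P? (h (f j)))) ∎
      where open ≡-Reasoning

  length-filter-allDraws : ∀ {n} {P : Pred (List (Fin n)) 0ℓ} (P? : Decidable P) r →
    length (filter P? (allDraws n (suc r))) ≡ sum (λ j → length (filter (P? ∘ (j ∷_)) (allDraws n r)))
  length-filter-allDraws {n} P? r =
    trans (length-filter-concatMap P? (λ j → map (j ∷_) (allDraws n r)) id)
          (sum-cong-≗ (λ j → length-filter-map P? (j ∷_) (allDraws n r)))

  module Stopping {n} (A B : Subset n) (A∩B≡⊥ : A ∩ B ≡ ⊥) where

    Covered : Subset n → Set
    Covered D = Done (unseen A D) (unseen B D)

    StopsAt : Subset n → ℕ → List (Fin n) → Set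
    StopsAt D r xs = Covered (D ∪ drawnSet (take r xs)) ×
                     (∀ (m : Fin r) → ¬ Covered (D ∪ drawnSet (take (toℕ m) xs)))

    stopsAt? : ∀ D r → Decidable (StopsAt D r)
    stopsAt? D r xs = done? _ _ ×-dec all? (λ m → ¬? (done? _ _))

    stopsAt-covered : ∀ {D r j xs} → Covered D → ¬ StopsAt D (suc r) (j ∷ xs)
    stopsAt-covered {D} covered (_ , notYet) = notYet zero (subst Covered (sym (∪-identityʳ D)) covered)

    stopsAt-∷ : ∀ {D r j} → ¬ Covered D → (StopsAt D (suc r) ∘ (j ∷_)) ≐ StopsAt (D ∪ ⁅ j ⁆) r
    stopsAt-∷ {D} {r} {j} uncovered = to , from
      where
      reassoc : ∀ X → D ∪ (⁅ j ⁆ ∪ X) ≡ (D ∪ ⁅ j ⁆) ∪ X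
      reassoc X = sym (∪-assoc D ⁅ j ⁆ X)
      to : ∀ {xs} → StopsAt D (suc r) (j ∷ xs) → StopsAt (D ∪ ⁅ j ⁆) r xs
      to (covered , notYet) =
        subst Covered (reassoc _) covered ,
        λ m → notYet (suc m) ∘ subst Covered (sym (reassoc _))
      from : ∀ {xs} → StopsAt (D ∪ ⁅ j ⁆) r xs → StopsAt D (suc r) (j ∷ xs)
      from (covered , notYet) = subst Covered (sym (reassoc _)) covered , notYetʹ
        where
        notYetʹ : ∀ (m : Fin (suc r)) → ¬ Covered (D ∪ drawnSet (take (toℕ m) (j ∷ _)))
        notYetʹ zero    = uncovered ∘ subst Covered (∪-identityʳ D)
        notYetʹ (suc m) = notYet m ∘ subst Covered (reassoc _)

    countStops : ∀ r D → length (filter (stopsAt? D r) (allDraws n r)) ≡ atProfile A B (stopCount r) D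
    countStops zero D with done? (unseen A D) (unseen B D)
    ... | yes covered = begin
      length (filter (stopsAt? D zero) ([] ∷ []))
        ≡⟨ cong length (filter-accept (stopsAt? D zero) (subst Covered (sym (∪-identityʳ D)) covered , λ ())) ⟩
      1
        ≡⟨ sym (stopCount-zero-done _ covered) ⟩
      atProfile A B (stopCount zero) D ∎
      where open ≡-Reasoning
    ... | no uncovered = begin
      length (filter (stopsAt? D zero) ([] ∷ []))
        ≡⟨ cong length (filter-reject (stopsAt? D zero) (uncovered ∘ subst Covered (∪-identityʳ D) ∘ proj₁)) ⟩
      0
        ≡⟨ sym (stopCount-zero-active _ uncovered) ⟩
      atProfile A B (stopCount zero) D ∎
      where open ≡-Reasoning
    countStops (suc r) D = trans (length-filter-allDraws (stopsAt? D (suc r)) r) (afterFirstDraw (done? _ _))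
      where
      afterFirstDraw : Dec (Covered D) →
        sum (λ j → length (filter (stopsAt? D (suc r) ∘ (j ∷_)) (allDraws n r))) ≡ atProfile A B (stopCount (suc r)) D
      afterFirstDraw (yes covered) = begin
        sum (λ j → length (filter (stopsAt? D (suc r) ∘ (j ∷_)) (allDraws n r)))
          ≡⟨ sum-cong-≗ {n} (λ j → cong length (filter-none (stopsAt? D (suc r) ∘ (j ∷_)) {allDraws n r}
                                                   (All.tabulate λ _ → stopsAt-covered covered))) ⟩
        sum {n} (λ _ → 0)
          ≡⟨ sum-replicate-zero n ⟩
        0
          ≡⟨ sym (stopCount-suc-done r _ covered) ⟩
        atProfile A B (stopCount (suc r)) D ∎
        where open ≡-Reasoning
      afterFirstDraw (no uncovered) = begin
        sum (λ j → length (filter (stopsAt? D (suc r) ∘ (j ∷_)) (allDraws n r)))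
          ≡⟨ sum-cong-≗ (λ j → cong length (filter-≐ _ (stopsAt? (D ∪ ⁅ j ⁆) r) (stopsAt-∷ uncovered) (allDraws n r))) ⟩
        sum (λ j → length (filter (stopsAt? (D ∪ ⁅ j ⁆) r) (allDraws n r)))
          ≡⟨ sum-cong-≗ (λ j → countStops r (D ∪ ⁅ j ⁆)) ⟩
        sum (λ j → atProfile A B (stopCount r) (D ∪ ⁅ j ⁆))
          ≡⟨ ∑-draw A B D A∩B≡⊥ (stopCount r) ⟩
        atProfile A B (oneDraw (stopCount r)) D
          ≡⟨ sym (stopCount-suc-active r _ uncovered) ⟩
        atProfile A B (stopCount (suc r)) D ∎
        where open ≡-Reasoning

  module _ {ℓ k n} (enc : Encoder ℓ k n) (i : Fin k) (retrieves? : ∀ J → Dec (IsRetrievalSet enc i J))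
           {A B : Subset n} (minimal⇔ : ∀ J → IsMinimalRetrievalSet enc i J ⇔ (J ≡ A ⊎ J ≡ B))
           (A∩B≡⊥ : A ∩ B ≡ ⊥) where

    open RetrievalSets enc i retrieves?
    open Stopping A B A∩B≡⊥

    retrieves⇔covered : ∀ J → Retrieves J ⇔ Covered (⊥ ∪ J)
    retrieves⇔covered J =
      subst (λ X → Retrieves J ⇔ Covered X) (sym (∪-identityˡ J))
        (⇔-trans (retrieves⇔ minimal⇔ J) (⇔-sym (unseen≡0⇔⊆ A J ⊎-⇔ unseen≡0⇔⊆ B J)))

    stopsExactlyAt≐stopsAt : ∀ r → StopsExactlyAt enc i r ≐ StopsAt ⊥ r
    stopsExactlyAt≐stopsAt r =
      (λ (retrieves , notYet) → to retrieves , λ m → notYet m ∘ from) ,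
      (λ (covered , notYet) → from covered , λ m → notYet m ∘ to)
      where
      to : ∀ {J} → Retrieves J → Covered (⊥ ∪ J)
      to = Equivalence.to (retrieves⇔covered _)
      from : ∀ {J} → Covered (⊥ ∪ J) → Retrieves J
      from = Equivalence.from (retrieves⇔covered _)

    countStopsExactlyAt : ∀ r → length (filter (stopsExactlyAt? enc i retrieves? r) (allDraws n r))
                                ≡ stopCount r ∣ A ∣ ∣ B ∣ (settled A B ⊥)
    countStopsExactlyAt r = begin
      length (filter (stopsExactlyAt? enc i retrieves? r) (allDraws n r))
        ≡⟨ cong length (filter-≐ _ (stopsAt? ⊥ r) (stopsExactlyAt≐stopsAt r) (allDraws n r)) ⟩
      length (filter (stopsAt? ⊥ r) (allDraws n r))
        ≡⟨ countStops r ⊥ ⟩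
      stopCount r (unseen A ⊥) (unseen B ⊥) (settled A B ⊥)
        ≡⟨ cong₂ (λ a b → stopCount r a b (settled A B ⊥)) (unseen-⊥ A) (unseen-⊥ B) ⟩
      stopCount r ∣ A ∣ ∣ B ∣ (settled A B ⊥) ∎
      where open ≡-Reasoning

module Growth where

  open import Data.Nat using (ℕ; zero; suc; _+_; _*_; _^_; _≤_; _<_; s≤s)
  open import Data.Nat.Properties
    using (≤-refl; ≤-trans; *-assoc; *-mono-≤; *-monoʳ-≤; +-monoˡ-≤; +-monoʳ-≤; *-monoˡ-<; *-monoʳ-<; *-cancelʳ-<;
           m≤m+n; m≤n+m; n≤1+n; m≤m*n; m^n≢0; module ≤-Reasoning)
  open import Data.Nat.Solver using (module +-*-Solver)
  open import Data.Product using (Σ; _,_)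
  open import Relation.Binary.PropositionalEquality using (_≡_; refl; sym)
  open +-*-Solver using (solve; _:+_; _:*_; _:=_; con)
  open ≤-Reasoning

  -- q (x + 1) / q x = (x + 2) / x is at most (d + 1) / d once x ≥ 2d.
  q : ℕ → ℕ
  q x = x * suc x

  q-step : ∀ d x → d + d ≤ x → d * q (suc x) ≤ suc d * q x
  q-step d x 2d≤x = begin
    d * (suc x * suc (suc x))
      ≡⟨ solve 2 (λ d x → d :* ((con 1 :+ x) :* (con 2 :+ x)) := (con 1 :+ x) :* ((d :+ d) :+ d :* x)) refl d x ⟩
    suc x * ((d + d) + d * x)
      ≤⟨ *-monoʳ-≤ (suc x) (+-monoˡ-≤ (d * x) 2d≤x) ⟩
    suc x * (x + d * x)
      ≡⟨ solve 2 (λ d x → (con 1 :+ x) :* (x :+ d :* x) := (con 1 :+ d) :* (x :* (con 1 :+ x))) refl d x ⟩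
    suc d * q x ∎

  d^m*q≤ : ∀ d m → d ^ m * q (m + (d + d)) ≤ suc d ^ m * q (d + d)
  d^m*q≤ d zero    = ≤-refl
  d^m*q≤ d (suc m) = begin
    d * d ^ m * q (suc (m + (d + d)))
      ≡⟨ solve 3 (λ d p r → d :* p :* r := p :* (d :* r)) refl d (d ^ m) (q (suc (m + (d + d)))) ⟩
    d ^ m * (d * q (suc (m + (d + d))))
      ≤⟨ *-monoʳ-≤ (d ^ m) (q-step d (m + (d + d)) (m≤n+m (d + d) m)) ⟩
    d ^ m * (suc d * q (m + (d + d)))
      ≡⟨ solve 3 (λ p s r → p :* (s :* r) := s :* (p :* r)) refl (d ^ m) (suc d) (q (m + (d + d))) ⟩
    suc d * (d ^ m * q (m + (d + d)))
      ≤⟨ *-monoʳ-≤ (suc d) (d^m*q≤ d m) ⟩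
    suc d * (suc d ^ m * q (d + d))
      ≡⟨ sym (*-assoc (suc d) (suc d ^ m) (q (d + d))) ⟩
    suc d * suc d ^ m * q (d + d) ∎

  eventually-< : ∀ d K → Σ ℕ λ N → ∀ M → N ≤ M → suc d * (M + suc d) * d ^ M * K < suc d ^ M
  eventually-< d K = suc (C * suc n) , bound
    where
    n = suc d
    C = n * K * q (d + d)
    bound : ∀ M → suc (C * suc n) ≤ M → n * (M + n) * d ^ M * K < n ^ M
    bound (suc m) (s≤s N≤m) = *-cancelʳ-< Q (n * (M + n) * d ^ M * K) (n ^ M) (begin-strict
      n * (M + n) * d ^ M * K * Q
        ≡⟨ solve 5 (λ n M D K Q → n :* M :* D :* K :* Q := n :* K :* M :* (D :* Q)) refl n (M + n) (d ^ M) K Q ⟩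
      n * K * (M + n) * (d ^ M * Q)
        ≤⟨ *-monoʳ-≤ (n * K * (M + n)) (d^m*q≤ d M) ⟩
      n * K * (M + n) * (n ^ M * q (d + d))
        ≡⟨ solve 5 (λ n K m P r → n :* K :* m :* (P :* r) := P :* (n :* K :* r :* m)) refl n K (M + n) (n ^ M) (q (d + d)) ⟩
      n ^ M * (C * (M + n))
        <⟨ *-monoʳ-< (n ^ M) {{m^n≢0 n M}} C*[M+n]<Q ⟩
      n ^ M * Q ∎)
      where
      M = suc m
      Q = q (M + (d + d))
      C*[M+n]<Q : C * (M + n) < Q
      C*[M+n]<Q = begin-strict
        C * (M + n)
          ≤⟨ *-monoʳ-≤ C (+-monoʳ-≤ M (m≤m*n n M)) ⟩
        C * (M + n * M)
          ≡⟨ sym (*-assoc C (suc n) M) ⟩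
        C * suc n * M
          <⟨ *-monoˡ-< M (s≤s N≤m) ⟩
        M * M
          ≤⟨ *-mono-≤ (m≤m+n M (d + d)) (≤-trans (m≤m+n M (d + d)) (n≤1+n (M + (d + d)))) ⟩
        Q ∎

open import Data.Fin using (Fin)
open import Data.Fin.Subset using (Subset; _∩_; ⊥) renaming (∣_∣ to #_)
open import Data.Integer using (+_)
import Data.Integer as ℤ
import Data.Integer.Properties as ℤ
open import Data.Nat using (ℕ; zero; suc; pred; _≥_; NonZero)
  renaming (_+_ to _+ℕ_; _*_ to _*ℕ_; _^_ to _^ℕ_; _≤_ to _≤ℕ_; _<_ to _<ℕ_)
import Data.Nat as ℕ
import Data.Nat.Properties as ℕ
open import Data.Product using (Σ; _×_; _,_; proj₁; proj₂)
open import Data.Sum using (_⊎_; inj₁; inj₂)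
open import Data.Rational using (ℚ; mkℚ; _+_; _-_; _*_; _/_; _≤_; _<_; -_; ∣_∣; 0ℚ; 1ℚ; ↧ₙ_; toℚᵘ)
import Data.Rational as ℚ
open import Data.Rational.Properties
  using (toℚᵘ-injective; toℚᵘ-fromℚᵘ; 0/n≡0; toℚᵘ-homo-+; toℚᵘ-homo-*; toℚᵘ-cancel-≤; toℚᵘ-cancel-<; ↥p/↧p≡p;
         ≤-refl; ≤-reflexive; ≤-trans; +-mono-≤; +-monoˡ-≤; +-monoʳ-≤; neg-antimono-≤;
         +-inverseʳ; +-identityʳ; +-comm; +-identityˡ; *-identityˡ; *-identityʳ; *-zeroʳ; *-assoc; *-distribˡ-+;
         nonNegative⁻¹; normalize-nonNeg; nonNeg*nonNeg⇒nonNeg; *-monoˡ-≤-nonNeg;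
         0≤p⇒∣p∣≡p; ∣p+q∣≤∣p∣+∣q∣; ∣p*q∣≡∣p∣*∣q∣; ∣-p∣≡∣p∣; module ≤-Reasoning)
open import Data.Rational.Unnormalised using (mkℚᵘ; *≡*; *≤*; *<*) renaming (_≃_ to _≃ᵘ_)
import Data.Rational.Unnormalised.Properties as ℚᵘ
open import Data.Rational.Solver using (module +-*-Solver)
open import Function.Bundles using (_⇔_)
open import Relation.Binary.PropositionalEquality
  using (_≡_; refl; sym; trans; cong; cong₂; subst; subst₂; module ≡-Reasoning)
open import Relation.Nullary using (Dec)

open Combinatorics
  using (Done; oneDraw; stopCount; stopCount-zero-done; stopCount-suc-done;
         settled; initialProfile-total; countStopsExactlyAt)
open Growth using (eventually-<)
open +-*-Solver

fromℕ : ℕ → ℚ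
fromℕ m = + m / 1

private
  toℚᵘ-/ : ∀ i k → toℚᵘ (i / suc k) ≃ᵘ mkℚᵘ i k
  toℚᵘ-/ i k = toℚᵘ-fromℚᵘ (mkℚᵘ i k)

fromℕ-+ : ∀ x y → fromℕ (x +ℕ y) ≡ fromℕ x + fromℕ y
fromℕ-+ x y = toℚᵘ-injective (ℚᵘ.≃-trans (toℚᵘ-/ (+ (x +ℕ y)) 0) (ℚᵘ.≃-trans (*≡* cross)
  (ℚᵘ.≃-sym (ℚᵘ.≃-trans (toℚᵘ-homo-+ (fromℕ x) (fromℕ y)) (ℚᵘ.+-cong (toℚᵘ-/ (+ x) 0) (toℚᵘ-/ (+ y) 0))))))
  where
  cross : + (x +ℕ y) ℤ.* + 1 ≡ (+ x ℤ.* + 1 ℤ.+ + y ℤ.* + 1) ℤ.* + 1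
  cross rewrite ℤ.*-identityʳ (+ x) | ℤ.*-identityʳ (+ y) | ℤ.*-identityʳ (+ x ℤ.+ + y) = refl

fromℕ-* : ∀ x y → fromℕ (x *ℕ y) ≡ fromℕ x * fromℕ y
fromℕ-* x y = toℚᵘ-injective (ℚᵘ.≃-trans (toℚᵘ-/ (+ (x *ℕ y)) 0) (ℚᵘ.≃-trans (*≡* cross)
  (ℚᵘ.≃-sym (ℚᵘ.≃-trans (toℚᵘ-homo-* (fromℕ x) (fromℕ y)) (ℚᵘ.*-cong (toℚᵘ-/ (+ x) 0) (toℚᵘ-/ (+ y) 0))))))
  where
  cross : + (x *ℕ y) ℤ.* + 1 ≡ (+ x ℤ.* + y) ℤ.* + 1
  cross = cong (ℤ._* + 1) (ℤ.pos-* x y)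

fromℕ-+₃ : ∀ x y z → fromℕ (x +ℕ y +ℕ z) ≡ fromℕ x + fromℕ y + fromℕ z
fromℕ-+₃ x y z = trans (fromℕ-+ (x +ℕ y) z) (cong (_+ fromℕ z) (fromℕ-+ x y))

/-fromℕ : ∀ x m .{{_ : NonZero m}} → + x / m ≡ fromℕ x * (+ 1 / m)
/-fromℕ x (suc k) = toℚᵘ-injective (ℚᵘ.≃-trans (toℚᵘ-/ (+ x) k) (ℚᵘ.≃-trans (*≡* cross)
  (ℚᵘ.≃-sym (ℚᵘ.≃-trans (toℚᵘ-homo-* (fromℕ x) (+ 1 / suc k)) (ℚᵘ.*-cong (toℚᵘ-/ (+ x) 0) (toℚᵘ-/ (+ 1) k))))))
  where
  cross : + x ℤ.* + (1 *ℕ suc k) ≡ (+ x ℤ.* + 1) ℤ.* + suc k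
  cross rewrite ℤ.*-identityʳ (+ x) | ℕ.*-identityˡ (suc k) = refl

/-*-denominator : ∀ x m k .{{_ : NonZero m}} .{{_ : NonZero k}} →
  _/_ (+ x) (m *ℕ k) {{ℕ.m*n≢0 m k}} ≡ (+ 1 / m) * (+ x / k)
/-*-denominator x (suc m) (suc k) = toℚᵘ-injective (ℚᵘ.≃-trans (toℚᵘ-/ (+ x) (k +ℕ m *ℕ suc k)) (ℚᵘ.≃-trans (*≡* cross)
  (ℚᵘ.≃-sym (ℚᵘ.≃-trans (toℚᵘ-homo-* (+ 1 / suc m) (+ x / suc k)) (ℚᵘ.*-cong (toℚᵘ-/ (+ 1) m) (toℚᵘ-/ (+ x) k))))))
  where
  cross : + x ℤ.* + (suc m *ℕ suc k) ≡ (+ 1 ℤ.* + x) ℤ.* + (suc m *ℕ suc k)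
  cross = cong (ℤ._* + (suc m *ℕ suc k)) (sym (ℤ.*-identityˡ (+ x)))

1/m*m≡1 : ∀ m .{{_ : NonZero m}} → (+ 1 / m) * fromℕ m ≡ 1ℚ
1/m*m≡1 (suc k) = toℚᵘ-injective (ℚᵘ.≃-trans (toℚᵘ-homo-* (+ 1 / suc k) (fromℕ (suc k)))
  (ℚᵘ.≃-trans (ℚᵘ.*-cong (toℚᵘ-/ (+ 1) k) (toℚᵘ-/ (+ suc k) 0)) (*≡* cross)))
  where
  cross : (+ 1 ℤ.* + suc k) ℤ.* + 1 ≡ + 1 ℤ.* + (suc k *ℕ 1)
  cross rewrite ℕ.*-identityʳ k | ℕ.*-identityʳ (k +ℕ 0) = refl

frac-≤ : ∀ i j k l → i ℤ.* + suc l ℤ.≤ j ℤ.* + suc k → i / suc k ≤ j / suc l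
frac-≤ i j k l cross = toℚᵘ-cancel-≤
  (ℚᵘ.≤-respˡ-≃ (ℚᵘ.≃-sym (toℚᵘ-/ i k)) (ℚᵘ.≤-respʳ-≃ (ℚᵘ.≃-sym (toℚᵘ-/ j l)) (*≤* cross)))

frac-< : ∀ i j k l → i ℤ.* + suc l ℤ.< j ℤ.* + suc k → i / suc k < j / suc l
frac-< i j k l cross = toℚᵘ-cancel-<
  (ℚᵘ.<-respˡ-≃ (ℚᵘ.≃-sym (toℚᵘ-/ i k)) (ℚᵘ.<-respʳ-≃ (ℚᵘ.≃-sym (toℚᵘ-/ j l)) (*<* cross)))

-- x / y < ε as soon as x · (denominator of ε) < y, since the numerator of ε is at least 1.
frac<ε : ∀ x y .{{_ : NonZero y}} ε → 0ℚ < ε → x *ℕ ℚ.↧ₙ ε <ℕ y → + x / y < ε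
frac<ε x (suc y) ε@(mkℚ (ℤ.+[1+ k ]) den _) _ small = subst (+ x / suc y <_) (↥p/↧p≡p ε)
  (frac-< (+ x) (+ suc k) y den
    (subst₂ ℤ._<_ (ℤ.pos-* x (suc den)) (ℤ.pos-* (suc k) (suc y)) (ℤ.+<+ (ℕ.<-≤-trans small (ℕ.m≤n*m (suc y) (suc k))))))
frac<ε x (suc y) (mkℚ (+ 0)          _ _) (ℚ.*<* (ℤ.+<+ ())) _
frac<ε x (suc y) (mkℚ (ℤ.-[1+ _ ]) _ _) (ℚ.*<* ()) _

fromℕ-*-frac : ∀ a x m .{{_ : NonZero m}} → fromℕ a * (+ x / m) ≡ + (a *ℕ x) / m
fromℕ-*-frac a x m = begin
  fromℕ a * (+ x / m)             ≡⟨ cong (fromℕ a *_) (/-fromℕ x m) ⟩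
  fromℕ a * (fromℕ x * (+ 1 / m))  ≡⟨ sym (*-assoc (fromℕ a) (fromℕ x) _) ⟩
  fromℕ a * fromℕ x * (+ 1 / m)    ≡⟨ cong (_* (+ 1 / m)) (sym (fromℕ-* a x)) ⟩
  fromℕ (a *ℕ x) * (+ 1 / m)      ≡⟨ sym (/-fromℕ (a *ℕ x) m) ⟩
  + (a *ℕ x) / m                  ∎
  where open ≡-Reasoning

frac-nonNeg : ∀ x m .{{_ : NonZero m}} → 0ℚ ≤ + x / m
frac-nonNeg x m = nonNegative⁻¹ (+ x / m) {{normalize-nonNeg x m}}

fromℕ-nonNeg : ∀ x → 0ℚ ≤ fromℕ x
fromℕ-nonNeg x = frac-nonNeg x 1

fromℕ-mono-≤ : ∀ {x y} → x ≤ℕ y → fromℕ x ≤ fromℕ y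
fromℕ-mono-≤ {x} {y} x≤y = frac-≤ (+ x) (+ y) 0 0 (ℤ.*-monoʳ-≤-nonNeg (+ 1) (ℤ.+≤+ x≤y))

1/-antimono-≤ : ∀ {a k} → a ≤ℕ k → + 1 / suc k ≤ + 1 / suc a
1/-antimono-≤ {a} {k} a≤k = frac-≤ (+ 1) (+ 1) k a
  (subst₂ ℤ._≤_ (sym (ℤ.*-identityˡ (+ suc a))) (sym (ℤ.*-identityˡ (+ suc k))) (ℤ.+≤+ (ℕ.s≤s a≤k)))

*-nonNeg : ∀ {p q} → 0ℚ ≤ p → 0ℚ ≤ q → 0ℚ ≤ p * q
*-nonNeg {p} {q} 0≤p 0≤q = nonNegative⁻¹ (p * q)
  {{nonNeg*nonNeg⇒nonNeg p {{ℚ.nonNegative 0≤p}} q {{ℚ.nonNegative 0≤q}}}}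

*-monoˡ-≤-0≤ : ∀ {r p q} → 0ℚ ≤ r → p ≤ q → r * p ≤ r * q
*-monoˡ-≤-0≤ {r} 0≤r = *-monoˡ-≤-nonNeg r {{ℚ.nonNegative 0≤r}}

∣r*p∣≤r*q : ∀ {r p q} → 0ℚ ≤ r → ∣ p ∣ ≤ q → ∣ r * p ∣ ≤ r * q
∣r*p∣≤r*q {r} {p} {q} 0≤r ∣p∣≤q =
  subst (_≤ r * q) (sym (trans (∣p*q∣≡∣p∣*∣q∣ r p) (cong (_* ∣ p ∣) (0≤p⇒∣p∣≡p 0≤r)))) (*-monoˡ-≤-0≤ 0≤r ∣p∣≤q)

∣p+q∣≤-+ : ∀ {p q s t} → ∣ p ∣ ≤ s → ∣ q ∣ ≤ t → ∣ p + q ∣ ≤ s + t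
∣p+q∣≤-+ {p} {q} ∣p∣≤s ∣q∣≤t = ≤-trans (∣p+q∣≤∣p∣+∣q∣ p q) (+-mono-≤ ∣p∣≤s ∣q∣≤t)

∣≡0∣≤ : ∀ {p q} → p ≡ 0ℚ → 0ℚ ≤ q → ∣ p ∣ ≤ q
∣≡0∣≤ refl 0≤q = 0≤q

∣p-q∣≡∣q-p∣ : ∀ p q → ∣ p - q ∣ ≡ ∣ q - p ∣
∣p-q∣≡∣q-p∣ p q = trans (cong ∣_∣ (solve 2 (λ p q → p :- q := :- (q :- p)) refl p q)) (∣-p∣≡∣p∣ (q - p))

*-distribˡ-− : ∀ p q r → p * q - p * r ≡ p * (q - r)
*-distribˡ-− = solve 3 (λ p q r → p :* q :- p :* r := p :* (q :- r)) refl

-- Harmonic numbers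

H≤fromℕ : ∀ a → H a ≤ fromℕ a
H≤fromℕ zero    = ≤-refl
H≤fromℕ (suc a) = subst (H (suc a) ≤_) (trans (+-comm (fromℕ a) 1ℚ) (sym (fromℕ-+ 1 a)))
  (+-mono-≤ (H≤fromℕ a) (1/-antimono-≤ {0} {a} ℕ.z≤n))

-- H (a + b) - H b = 1/(b+1) + ... + 1/(b+a), termwise at most H a.
H-+-bounds : ∀ a b → 0ℚ ≤ H (a +ℕ b) - H b × H (a +ℕ b) - H b ≤ H a
H-+-bounds zero    b = ≤-reflexive (sym (+-inverseʳ (H b))) , ≤-reflexive (+-inverseʳ (H b))
H-+-bounds (suc a) b =
  subst (0ℚ ≤_) (sym unfold) (+-mono-≤ (proj₁ (H-+-bounds a b)) (frac-nonNeg 1 (suc (a +ℕ b)))) ,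
  subst (_≤ H (suc a)) (sym unfold) (+-mono-≤ (proj₂ (H-+-bounds a b)) (1/-antimono-≤ (ℕ.m≤m+n a b)))
  where
  unfold : H (suc a +ℕ b) - H b ≡ (H (a +ℕ b) - H b) + + 1 / suc (a +ℕ b)
  unfold = solve 3 (λ x y z → x :+ z :- y := (x :- y) :+ z) refl (H (a +ℕ b)) (H b) (+ 1 / suc (a +ℕ b))

harmonicGap : ℕ → ℕ → ℚ
harmonicGap a b = H a + H b - H (a +ℕ b)

harmonicGap-done : ∀ {a b} → Done a b → harmonicGap a b ≡ 0ℚ
harmonicGap-done {zero}  {b} _ = trans (cong (_- H b) (+-identityˡ (H b))) (+-inverseʳ (H b))
harmonicGap-done {suc a} {zero} _ rewrite ℕ.+-identityʳ a =
  trans (cong (_- H (suc a)) (+-identityʳ (H (suc a)))) (+-inverseʳ (H (suc a)))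
harmonicGap-done {suc a} {suc b} (inj₁ ())
harmonicGap-done {suc a} {suc b} (inj₂ ())

harmonicGap-bounds : ∀ a b → 0ℚ ≤ harmonicGap a b × harmonicGap a b ≤ fromℕ a
harmonicGap-bounds a b =
  subst (0ℚ ≤_) (sym regroup) lower , subst (_≤ fromℕ a) (sym regroup) (≤-trans upper (H≤fromℕ a))
  where
  tailSum = H (a +ℕ b) - H b
  regroup : harmonicGap a b ≡ H a + - tailSum
  regroup = solve 3 (λ x y z → x :+ y :- z := x :+ :- (z :- y)) refl (H a) (H b) (H (a +ℕ b))
  lower : 0ℚ ≤ H a + - tailSum
  lower = subst (_≤ H a + - tailSum) (+-inverseʳ tailSum) (+-monoˡ-≤ (- tailSum) (proj₂ (H-+-bounds a b)))
  upper : H a + - tailSum ≤ H a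
  upper = subst (H a + - tailSum ≤_) (+-identityʳ (H a)) (+-monoʳ-≤ (H a) (neg-antimono-≤ (proj₁ (H-+-bounds a b))))

harmonicGap-step : ∀ a b →
  fromℕ (suc a +ℕ suc b) * harmonicGap (suc a) (suc b)
    ≡ fromℕ (suc a) * harmonicGap a (suc b) + fromℕ (suc b) * harmonicGap (suc a) b + 1ℚ
harmonicGap-step a b = begin
  fromℕ (suc a +ℕ suc b) * harmonicGap (suc a) (suc b)
    ≡⟨ cong (_* harmonicGap (suc a) (suc b)) (fromℕ-+ (suc a) (suc b)) ⟩
  (A + B) * ((X + x) + (Y + y) - (Z + z))
    ≡⟨ expand A B X Y Z x y z ⟩
  R + ((x * A - 1ℚ) + (y * B - 1ℚ) - (z * (A + B) - 1ℚ))
    ≡⟨ cong (_+_ R) (cancel (1/m*m≡1 (suc a)) (1/m*m≡1 (suc b)) z*[A+B]≡1) ⟩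
  R + 0ℚ
    ≡⟨ +-identityʳ R ⟩
  A * harmonicGap a (suc b) + B * ((X + x) + Y - Z) + 1ℚ
    ≡⟨ cong (λ t → A * harmonicGap a (suc b) + B * ((X + x) + Y - H t) + 1ℚ) (ℕ.+-suc a b) ⟩
  A * harmonicGap a (suc b) + B * harmonicGap (suc a) b + 1ℚ ∎
  where
  open ≡-Reasoning
  A = fromℕ (suc a)
  B = fromℕ (suc b)
  X = H a
  Y = H b
  Z = H (a +ℕ suc b)
  x = + 1 / suc a
  y = + 1 / suc b
  z = + 1 / suc (a +ℕ suc b)
  R = A * (X + (Y + y) - Z) + B * ((X + x) + Y - Z) + 1ℚ
  z*[A+B]≡1 : z * (A + B) ≡ 1ℚ
  z*[A+B]≡1 = trans (cong (z *_) (sym (fromℕ-+ (suc a) (suc b)))) (1/m*m≡1 (suc (a +ℕ suc b)))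
  expand : ∀ A B X Y Z x y z → (A + B) * ((X + x) + (Y + y) - (Z + z))
    ≡ A * (X + (Y + y) - Z) + B * ((X + x) + Y - Z) + 1ℚ + ((x * A - 1ℚ) + (y * B - 1ℚ) - (z * (A + B) - 1ℚ))
  expand = solve 8 (λ A B X Y Z x y z → (A :+ B) :* ((X :+ x) :+ (Y :+ y) :- (Z :+ z))
    := A :* (X :+ (Y :+ y) :- Z) :+ B :* ((X :+ x) :+ Y :- Z) :+ con 1ℚ
       :+ ((x :* A :- con 1ℚ) :+ (y :* B :- con 1ℚ) :- (z :* (A :+ B) :- con 1ℚ))) refl
  cancel : ∀ {p q r} → p ≡ 1ℚ → q ≡ 1ℚ → r ≡ 1ℚ → (p - 1ℚ) + (q - 1ℚ) - (r - 1ℚ) ≡ 0ℚ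
  cancel refl refl refl = refl

moveˡ : ∀ {a b c m} → suc a +ℕ b +ℕ c ≡ m → a +ℕ b +ℕ suc c ≡ m
moveˡ {a} {b} {c} total = trans (ℕ.+-suc (a +ℕ b) c) total

moveʳ : ∀ {a b c m} → a +ℕ suc b +ℕ c ≡ m → a +ℕ b +ℕ suc c ≡ m
moveʳ {a} {b} {c} total = trans (ℕ.+-suc (a +ℕ b) c) (trans (cong (_+ℕ c) (sym (ℕ.+-suc a b))) total)

oneDrawℚ : (ℕ → ℕ → ℕ → ℚ) → ℕ → ℕ → ℕ → ℚ
oneDrawℚ G a b c = fromℕ a * G (pred a) b (suc c) + fromℕ b * G a (pred b) (suc c) + fromℕ c * G a b c

fromℕ-oneDraw : ∀ G a b c → fromℕ (oneDraw G a b c) ≡ oneDrawℚ (λ x y z → fromℕ (G x y z)) a b c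
fromℕ-oneDraw G a b c =
  trans (fromℕ-+ (a *ℕ G (pred a) b (suc c) +ℕ b *ℕ G a (pred b) (suc c)) (c *ℕ G a b c))
    (cong₂ _+_ (trans (fromℕ-+ (a *ℕ G (pred a) b (suc c)) (b *ℕ G a (pred b) (suc c)))
                      (cong₂ _+_ (fromℕ-* a _) (fromℕ-* b _)))
               (fromℕ-* c _))

module _ {G K : ℕ → ℕ → ℕ → ℚ} (a b c : ℕ) where

  oneDrawℚ-cong : (∀ x y z → G x y z ≡ K x y z) → oneDrawℚ G a b c ≡ oneDrawℚ K a b c
  oneDrawℚ-cong G≡K =
    cong₂ _+_ (cong₂ _+_ (cong (fromℕ a *_) (G≡K _ _ _)) (cong (fromℕ b *_) (G≡K _ _ _)))
              (cong (fromℕ c *_) (G≡K _ _ _))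

  oneDrawℚ-+ : oneDrawℚ (λ x y z → G x y z + K x y z) a b c ≡ oneDrawℚ G a b c + oneDrawℚ K a b c
  oneDrawℚ-+ = solve 9 (λ A B C g₁ g₂ g₃ k₁ k₂ k₃ →
    A :* (g₁ :+ k₁) :+ B :* (g₂ :+ k₂) :+ C :* (g₃ :+ k₃)
      := (A :* g₁ :+ B :* g₂ :+ C :* g₃) :+ (A :* k₁ :+ B :* k₂ :+ C :* k₃)) refl
    (fromℕ a) (fromℕ b) (fromℕ c) (G (pred a) b (suc c)) (G a (pred b) (suc c)) (G a b c)
    (K (pred a) b (suc c)) (K a (pred b) (suc c)) (K a b c)

  oneDrawℚ-− : oneDrawℚ (λ x y z → G x y z - K x y z) a b c ≡ oneDrawℚ G a b c - oneDrawℚ K a b c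
  oneDrawℚ-− = solve 9 (λ A B C g₁ g₂ g₃ k₁ k₂ k₃ →
    A :* (g₁ :- k₁) :+ B :* (g₂ :- k₂) :+ C :* (g₃ :- k₃)
      := (A :* g₁ :+ B :* g₂ :+ C :* g₃) :- (A :* k₁ :+ B :* k₂ :+ C :* k₃)) refl
    (fromℕ a) (fromℕ b) (fromℕ c) (G (pred a) b (suc c)) (G a (pred b) (suc c)) (G a b c)
    (K (pred a) b (suc c)) (K a (pred b) (suc c)) (K a b c)

  ∣oneDrawℚ∣≤ : ∣ G (pred a) b (suc c) ∣ ≤ K (pred a) b (suc c) → ∣ G a (pred b) (suc c) ∣ ≤ K a (pred b) (suc c) →
                ∣ G a b c ∣ ≤ K a b c → ∣ oneDrawℚ G a b c ∣ ≤ oneDrawℚ K a b c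
  ∣oneDrawℚ∣≤ ≤₁ ≤₂ ≤₃ = ∣p+q∣≤-+ (∣p+q∣≤-+ (∣r*p∣≤r*q (fromℕ-nonNeg a) ≤₁) (∣r*p∣≤r*q (fromℕ-nonNeg b) ≤₂))
                                 (∣r*p∣≤r*q (fromℕ-nonNeg c) ≤₃)

oneDrawℚ-*ʳ : ∀ G k a b c → oneDrawℚ (λ x y z → G x y z * k) a b c ≡ oneDrawℚ G a b c * k
oneDrawℚ-*ʳ G k a b c = solve 7 (λ A B C g₁ g₂ g₃ k →
  A :* (g₁ :* k) :+ B :* (g₂ :* k) :+ C :* (g₃ :* k) := (A :* g₁ :+ B :* g₂ :+ C :* g₃) :* k) refl
  (fromℕ a) (fromℕ b) (fromℕ c) (G (pred a) b (suc c)) (G a (pred b) (suc c)) (G a b c) k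

oneDrawℚ-1 : ∀ a b c → oneDrawℚ (λ _ _ _ → 1ℚ) a b c ≡ fromℕ (a +ℕ b +ℕ c)
oneDrawℚ-1 a b c = trans
  (solve 3 (λ A B C → A :* con 1ℚ :+ B :* con 1ℚ :+ C :* con 1ℚ := A :+ B :+ C) refl (fromℕ a) (fromℕ b) (fromℕ c))
  (sym (fromℕ-+₃ a b c))

oneDrawℚ-linear : ∀ k a b c → oneDrawℚ (λ x _ _ → fromℕ x * k) (suc a) b c ≡ fromℕ (suc a) * k * fromℕ (a +ℕ b +ℕ c)
oneDrawℚ-linear k a b c = trans
  (solve 5 (λ A₁ A B C k → A₁ :* (A :* k) :+ B :* (A₁ :* k) :+ C :* (A₁ :* k) := A₁ :* k :* (A :+ B :+ C)) refl
    (fromℕ (suc a)) (fromℕ a) (fromℕ b) (fromℕ c) k)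
  (cong (fromℕ (suc a) * k *_) (sym (fromℕ-+₃ a b c)))

-- The stopping-time series

module Series (d : ℕ) where

  n : ℕ
  n = suc d

  u : ℚ
  u = + 1 / n

  1/nʳ : ℕ → ℚ
  1/nʳ r = _/_ (+ 1) (n ^ℕ r) {{ℕ.m^n≢0 n r}}

  stopProb : ℕ → ℕ → ℕ → ℕ → ℚ
  stopProb r a b c = _/_ (+ stopCount r a b c) (n ^ℕ r) {{ℕ.m^n≢0 n r}}

  stopProb≡ : ∀ r a b c → stopProb r a b c ≡ fromℕ (stopCount r a b c) * 1/nʳ r
  stopProb≡ r a b c = /-fromℕ (stopCount r a b c) (n ^ℕ r) {{ℕ.m^n≢0 n r}}

  stopProb-suc : ∀ r a b c → stopProb (suc r) (suc a) (suc b) c ≡ u * oneDrawℚ (stopProb r) (suc a) (suc b) c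
  stopProb-suc r a b c = begin
    stopProb (suc r) (suc a) (suc b) c
      ≡⟨ /-*-denominator (oneDraw (stopCount r) (suc a) (suc b) c) n (n ^ℕ r) {{_}} {{ℕ.m^n≢0 n r}} ⟩
    u * (_/_ (+ oneDraw (stopCount r) (suc a) (suc b) c) (n ^ℕ r) {{ℕ.m^n≢0 n r}})
      ≡⟨ cong (u *_) (/-fromℕ (oneDraw (stopCount r) (suc a) (suc b) c) (n ^ℕ r) {{ℕ.m^n≢0 n r}}) ⟩
    u * (fromℕ (oneDraw (stopCount r) (suc a) (suc b) c) * 1/nʳ r)
      ≡⟨ cong (λ t → u * (t * 1/nʳ r)) (fromℕ-oneDraw (stopCount r) (suc a) (suc b) c) ⟩
    u * (oneDrawℚ (λ x y z → fromℕ (stopCount r x y z)) (suc a) (suc b) c * 1/nʳ r)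
      ≡⟨ cong (u *_) (sym (oneDrawℚ-*ʳ (λ x y z → fromℕ (stopCount r x y z)) (1/nʳ r) (suc a) (suc b) c)) ⟩
    u * oneDrawℚ (λ x y z → fromℕ (stopCount r x y z) * 1/nʳ r) (suc a) (suc b) c
      ≡⟨ cong (u *_) (oneDrawℚ-cong (suc a) (suc b) c (λ x y z → sym (stopProb≡ r x y z))) ⟩
    u * oneDrawℚ (stopProb r) (suc a) (suc b) c ∎
    where open ≡-Reasoning

  mass : ℕ → ℕ → ℕ → ℕ → ℚ
  mass zero    a b c = stopProb zero a b c
  mass (suc M) a b c = mass M a b c + stopProb (suc M) a b c

  moment : ℕ → ℕ → ℕ → ℕ → ℚ
  moment zero    a b c = 0ℚ
  moment (suc M) a b c = moment M a b c + fromℕ (suc M) * stopProb (suc M) a b c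

  stopProb-done : ∀ r {a b} c → Done a b → stopProb (suc r) a b c ≡ 0ℚ
  stopProb-done r c done rewrite stopCount-suc-done r c done = 0/n≡0 (n ^ℕ suc r) {{ℕ.m^n≢0 n (suc r)}}

  mass-done : ∀ M {a b} c → Done a b → mass M a b c ≡ 1ℚ
  mass-done zero    c done rewrite stopCount-zero-done c done = refl
  mass-done (suc M) c done = cong₂ _+_ (mass-done M c done) (stopProb-done M c done)

  moment-done : ∀ M {a b} c → Done a b → moment M a b c ≡ 0ℚ
  moment-done zero    c done = refl
  moment-done (suc M) c done =
    trans (cong₂ (λ p q → p + fromℕ (suc M) * q) (moment-done M c done) (stopProb-done M c done))
          (solve 1 (λ m → con 0ℚ :+ m :* con 0ℚ := con 0ℚ) refl (fromℕ (suc M)))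

  mass-suc : ∀ M a b c → mass (suc M) (suc a) (suc b) c ≡ u * oneDrawℚ (mass M) (suc a) (suc b) c
  mass-suc zero    a b c = trans (+-identityˡ _) (stopProb-suc zero a b c)
  mass-suc (suc M) a b c = begin
    mass (suc M) s₁ s₂ c + stopProb (suc (suc M)) s₁ s₂ c
      ≡⟨ cong₂ _+_ (mass-suc M a b c) (stopProb-suc (suc M) a b c) ⟩
    u * oneDrawℚ (mass M) s₁ s₂ c + u * oneDrawℚ (stopProb (suc M)) s₁ s₂ c
      ≡⟨ sym (*-distribˡ-+ u _ _) ⟩
    u * (oneDrawℚ (mass M) s₁ s₂ c + oneDrawℚ (stopProb (suc M)) s₁ s₂ c)
      ≡⟨ cong (u *_) (sym (oneDrawℚ-+ {mass M} {stopProb (suc M)} s₁ s₂ c)) ⟩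
    u * oneDrawℚ (mass (suc M)) s₁ s₂ c ∎
    where
    open ≡-Reasoning
    s₁ = suc a
    s₂ = suc b

  moment-suc : ∀ M a b c →
    moment (suc M) (suc a) (suc b) c ≡ u * oneDrawℚ (λ x y z → moment M x y z + mass M x y z) (suc a) (suc b) c
  moment-suc zero    a b c = begin
    0ℚ + 1ℚ * stopProb 1 (suc a) (suc b) c
      ≡⟨ trans (+-identityˡ _) (*-identityˡ _) ⟩
    stopProb 1 (suc a) (suc b) c
      ≡⟨ stopProb-suc zero a b c ⟩
    u * oneDrawℚ (stopProb zero) (suc a) (suc b) c
      ≡⟨ cong (u *_) (oneDrawℚ-cong {stopProb zero} {λ x y z → 0ℚ + mass zero x y z} (suc a) (suc b) c
                                      (λ x y z → sym (+-identityˡ _))) ⟩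
    u * oneDrawℚ (λ x y z → 0ℚ + mass zero x y z) (suc a) (suc b) c ∎
    where open ≡-Reasoning
  moment-suc (suc M) a b c = begin
    moment (suc M) s₁ s₂ c + fromℕ (suc (suc M)) * stopProb (suc (suc M)) s₁ s₂ c
      ≡⟨ cong₂ (λ p q → p + fromℕ (suc (suc M)) * q) (moment-suc M a b c) (stopProb-suc (suc M) a b c) ⟩
    u * oneDrawℚ G s₁ s₂ c + fromℕ (suc (suc M)) * (u * oneDrawℚ (stopProb (suc M)) s₁ s₂ c)
      ≡⟨ solve 4 (λ u g m p → u :* g :+ m :* (u :* p) := u :* (g :+ p :* m)) refl
           u (oneDrawℚ G s₁ s₂ c) (fromℕ (suc (suc M))) (oneDrawℚ (stopProb (suc M)) s₁ s₂ c) ⟩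
    u * (oneDrawℚ G s₁ s₂ c + oneDrawℚ (stopProb (suc M)) s₁ s₂ c * fromℕ (suc (suc M)))
      ≡⟨ cong (λ t → u * (oneDrawℚ G s₁ s₂ c + t)) (sym (oneDrawℚ-*ʳ (stopProb (suc M)) (fromℕ (suc (suc M))) s₁ s₂ c)) ⟩
    u * (oneDrawℚ G s₁ s₂ c + oneDrawℚ (λ x y z → stopProb (suc M) x y z * fromℕ (suc (suc M))) s₁ s₂ c)
      ≡⟨ cong (u *_) (sym (oneDrawℚ-+ {G} {λ x y z → stopProb (suc M) x y z * fromℕ (suc (suc M))} s₁ s₂ c)) ⟩
    u * oneDrawℚ (λ x y z → G x y z + stopProb (suc M) x y z * fromℕ (suc (suc M))) s₁ s₂ c
      ≡⟨ cong (u *_) (oneDrawℚ-cong s₁ s₂ c regroup) ⟩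
    u * oneDrawℚ (λ x y z → moment (suc M) x y z + mass (suc M) x y z) s₁ s₂ c ∎
    where
    open ≡-Reasoning
    s₁ = suc a
    s₂ = suc b
    G : ℕ → ℕ → ℕ → ℚ
    G x y z = moment M x y z + mass M x y z
    regroup : ∀ x y z → G x y z + stopProb (suc M) x y z * fromℕ (suc (suc M))
                      ≡ moment (suc M) x y z + mass (suc M) x y z
    regroup x y z = trans (cong (λ t → G x y z + stopProb (suc M) x y z * t) (fromℕ-+ 1 (suc M)))
      (solve 4 (λ m q p k → (m :+ q) :+ p :* (con 1ℚ :+ k) := (m :+ k :* p) :+ (q :+ p)) refl
        (moment M x y z) (mass M x y z) (stopProb (suc M) x y z) (fromℕ (suc M)))

  expectedStop : ℕ → ℕ → ℚ
  expectedStop a b = fromℕ n * harmonicGap a b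

  expectedStop-step : ∀ a b c → suc a +ℕ suc b +ℕ c ≡ n →
    expectedStop (suc a) (suc b) ≡ u * oneDrawℚ (λ x y _ → expectedStop x y + 1ℚ) (suc a) (suc b) c
  expectedStop-step a b c total = begin
    N * g
      ≡⟨ cong (_* g) N≡S ⟩
    S * g
      ≡⟨ cong (_* g) (sym (*-identityˡ S)) ⟩
    (1ℚ * S) * g
      ≡⟨ cong (λ t → (t * S) * g) (sym u*N≡1) ⟩
    (u * N) * S * g
      ≡⟨ cong (λ t → u * t * S * g) N≡S ⟩
    (u * S) * S * g
      ≡⟨ solve 5 (λ u A B C g → u :* (A :+ B :+ C) :* (A :+ B :+ C) :* g
                   := u :* ((A :+ B :+ C) :* ((A :+ B) :* g) :+ (A :+ B :+ C) :* (C :* g))) refl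
           u A B C g ⟩
    u * (S * ((A + B) * g) + S * (C * g))
      ≡⟨ cong (λ t → u * (S * t + S * (C * g))) (trans (cong (_* g) (sym (fromℕ-+ (suc a) (suc b)))) (harmonicGap-step a b)) ⟩
    u * (S * (A * gA + B * gB + 1ℚ) + S * (C * g))
      ≡⟨ solve 7 (λ u A B C g gₐ g_b → u :* ((A :+ B :+ C) :* (A :* gₐ :+ B :* g_b :+ con 1ℚ) :+ (A :+ B :+ C) :* (C :* g))
                   := u :* (A :* ((A :+ B :+ C) :* gₐ :+ con 1ℚ) :+ B :* ((A :+ B :+ C) :* g_b :+ con 1ℚ)
                            :+ C :* ((A :+ B :+ C) :* g :+ con 1ℚ))) refl
           u A B C g gA gB ⟩
    u * (A * (S * gA + 1ℚ) + B * (S * gB + 1ℚ) + C * (S * g + 1ℚ))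
      ≡⟨ cong (λ t → u * (A * (t * gA + 1ℚ) + B * (t * gB + 1ℚ) + C * (t * g + 1ℚ))) (sym N≡S) ⟩
    u * oneDrawℚ (λ x y _ → expectedStop x y + 1ℚ) (suc a) (suc b) c ∎
    where
    open ≡-Reasoning
    N = fromℕ n
    A = fromℕ (suc a)
    B = fromℕ (suc b)
    C = fromℕ c
    S = A + B + C
    g = harmonicGap (suc a) (suc b)
    gA = harmonicGap a (suc b)
    gB = harmonicGap (suc a) b
    N≡S : N ≡ S
    N≡S = trans (cong fromℕ (sym total)) (fromℕ-+₃ (suc a) (suc b) c)
    u*N≡1 : u * N ≡ 1ℚ
    u*N≡1 = 1/m*m≡1 n

  survival : ℕ → ℕ → ℕ → ℕ → ℚ
  survival M a b c = 1ℚ - mass M a b c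

  error : ℕ → ℕ → ℕ → ℕ → ℚ
  error M a b c = expectedStop a b - moment M a b c

  survival-suc : ∀ M a b c → suc a +ℕ suc b +ℕ c ≡ n →
    survival (suc M) (suc a) (suc b) c ≡ u * oneDrawℚ (survival M) (suc a) (suc b) c
  survival-suc M a b c total = begin
    1ℚ - mass (suc M) (suc a) (suc b) c
      ≡⟨ cong₂ _-_ (sym (1/m*m≡1 n)) (mass-suc M a b c) ⟩
    u * fromℕ n - u * oneDrawℚ (mass M) (suc a) (suc b) c
      ≡⟨ cong (λ t → u * t - u * oneDrawℚ (mass M) (suc a) (suc b) c)
              (trans (cong fromℕ (sym total)) (sym (oneDrawℚ-1 (suc a) (suc b) c))) ⟩
    u * oneDrawℚ (λ _ _ _ → 1ℚ) (suc a) (suc b) c - u * oneDrawℚ (mass M) (suc a) (suc b) c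
      ≡⟨ *-distribˡ-− u _ _ ⟩
    u * (oneDrawℚ (λ _ _ _ → 1ℚ) (suc a) (suc b) c - oneDrawℚ (mass M) (suc a) (suc b) c)
      ≡⟨ cong (u *_) (sym (oneDrawℚ-− {λ _ _ _ → 1ℚ} {mass M} (suc a) (suc b) c)) ⟩
    u * oneDrawℚ (survival M) (suc a) (suc b) c ∎
    where open ≡-Reasoning

  error-suc : ∀ M a b c → suc a +ℕ suc b +ℕ c ≡ n →
    error (suc M) (suc a) (suc b) c ≡ u * oneDrawℚ (λ x y z → error M x y z + survival M x y z) (suc a) (suc b) c
  error-suc M a b c total = begin
    expectedStop (suc a) (suc b) - moment (suc M) (suc a) (suc b) c
      ≡⟨ cong₂ _-_ (expectedStop-step a b c total) (moment-suc M a b c) ⟩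
    u * oneDrawℚ F (suc a) (suc b) c - u * oneDrawℚ G (suc a) (suc b) c
      ≡⟨ *-distribˡ-− u _ _ ⟩
    u * (oneDrawℚ F (suc a) (suc b) c - oneDrawℚ G (suc a) (suc b) c)
      ≡⟨ cong (u *_) (sym (oneDrawℚ-− {F} {G} (suc a) (suc b) c)) ⟩
    u * oneDrawℚ (λ x y z → F x y z - G x y z) (suc a) (suc b) c
      ≡⟨ cong (u *_) (oneDrawℚ-cong (suc a) (suc b) c regroup) ⟩
    u * oneDrawℚ (λ x y z → error M x y z + survival M x y z) (suc a) (suc b) c ∎
    where
    open ≡-Reasoning
    F G : ℕ → ℕ → ℕ → ℚ
    F x y _ = expectedStop x y + 1ℚ
    G x y z = moment M x y z + mass M x y z
    regroup : ∀ x y z → F x y z - G x y z ≡ error M x y z + survival M x y z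
    regroup x y z = solve 3 (λ e m q → (e :+ con 1ℚ) :- (m :+ q) := (e :- m) :+ (con 1ℚ :- q)) refl
      (expectedStop x y) (moment M x y z) (mass M x y z)

  survival-done : ∀ M {a b} c → Done a b → survival M a b c ≡ 0ℚ
  survival-done M c done = cong (_-_ 1ℚ) (mass-done M c done)

  error-done : ∀ M {a b} c → Done a b → error M a b c ≡ 0ℚ
  error-done M c done = cong₂ _-_ (trans (cong (fromℕ n *_) (harmonicGap-done done)) (*-zeroʳ (fromℕ n)))
                                  (moment-done M c done)

  decay : ℕ → ℚ
  decay M = _/_ (+ d ^ℕ M) (n ^ℕ M) {{ℕ.m^n≢0 n M}}

  decay-nonNeg : ∀ M → 0ℚ ≤ decay M
  decay-nonNeg M = frac-nonNeg (d ^ℕ M) (n ^ℕ M) {{ℕ.m^n≢0 n M}}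

  decay-suc : ∀ M → decay (suc M) ≡ decay M * (u * fromℕ d)
  decay-suc M = begin
    decay (suc M)
      ≡⟨ /-*-denominator (d *ℕ d ^ℕ M) n (n ^ℕ M) {{_}} {{ℕ.m^n≢0 n M}} ⟩
    u * (_/_ (+ (d *ℕ d ^ℕ M)) (n ^ℕ M) {{ℕ.m^n≢0 n M}})
      ≡⟨ cong (u *_) (/-fromℕ (d *ℕ d ^ℕ M) (n ^ℕ M) {{ℕ.m^n≢0 n M}}) ⟩
    u * (fromℕ (d *ℕ d ^ℕ M) * 1/nʳ M)
      ≡⟨ cong (λ t → u * (t * 1/nʳ M)) (fromℕ-* d (d ^ℕ M)) ⟩
    u * (fromℕ d * fromℕ (d ^ℕ M) * 1/nʳ M)
      ≡⟨ solve 4 (λ u D P w → u :* (D :* P :* w) := (P :* w) :* (u :* D)) refl u (fromℕ d) (fromℕ (d ^ℕ M)) (1/nʳ M) ⟩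
    fromℕ (d ^ℕ M) * 1/nʳ M * (u * fromℕ d)
      ≡⟨ cong (_* (u * fromℕ d)) (sym (/-fromℕ (d ^ℕ M) (n ^ℕ M) {{ℕ.m^n≢0 n M}})) ⟩
    decay M * (u * fromℕ d) ∎
    where open ≡-Reasoning

  u-nonNeg : 0ℚ ≤ u
  u-nonNeg = frac-nonNeg 1 n

  u*oneDrawℚ-linear : ∀ k a b c → suc a +ℕ b +ℕ c ≡ n →
    u * oneDrawℚ (λ x _ _ → fromℕ x * k) (suc a) b c ≡ fromℕ (suc a) * (k * (u * fromℕ d))
  u*oneDrawℚ-linear k a b c total = begin
    u * oneDrawℚ (λ x _ _ → fromℕ x * k) (suc a) b c
      ≡⟨ cong (u *_) (oneDrawℚ-linear k a b c) ⟩
    u * (fromℕ (suc a) * k * fromℕ (a +ℕ b +ℕ c))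
      ≡⟨ cong (λ t → u * (fromℕ (suc a) * k * fromℕ t)) (ℕ.suc-injective total) ⟩
    u * (fromℕ (suc a) * k * fromℕ d)
      ≡⟨ solve 4 (λ u A k D → u :* (A :* k :* D) := A :* (k :* (u :* D))) refl u (fromℕ (suc a)) k (fromℕ d) ⟩
    fromℕ (suc a) * (k * (u * fromℕ d)) ∎
    where open ≡-Reasoning

  survival-bound : ∀ M a b c → a +ℕ b +ℕ c ≡ n → ∣ survival M a b c ∣ ≤ fromℕ a * decay M
  survival-bound M zero b c _ =
    ∣≡0∣≤ (survival-done M c (inj₁ refl)) (*-nonNeg (fromℕ-nonNeg 0) (decay-nonNeg M))
  survival-bound M (suc a) zero c _ =
    ∣≡0∣≤ (survival-done M c (inj₂ refl)) (*-nonNeg (fromℕ-nonNeg (suc a)) (decay-nonNeg M))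
  survival-bound zero (suc a) (suc b) c _ =
    subst (1ℚ ≤_) (sym (*-identityʳ (fromℕ (suc a)))) (fromℕ-mono-≤ {1} {suc a} (ℕ.s≤s ℕ.z≤n))
  survival-bound (suc M) (suc a) (suc b) c total = begin
    ∣ survival (suc M) (suc a) (suc b) c ∣
      ≡⟨ cong ∣_∣ (survival-suc M a b c total) ⟩
    ∣ u * oneDrawℚ (survival M) (suc a) (suc b) c ∣
      ≤⟨ ∣r*p∣≤r*q u-nonNeg (∣oneDrawℚ∣≤ {survival M} {λ x _ _ → fromℕ x * decay M} (suc a) (suc b) c
           (survival-bound M a (suc b) (suc c) (moveˡ {a} {suc b} total))
           (survival-bound M (suc a) b (suc c) (moveʳ {suc a} {b} total))
           (survival-bound M (suc a) (suc b) c total)) ⟩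
    u * oneDrawℚ (λ x _ _ → fromℕ x * decay M) (suc a) (suc b) c
      ≡⟨ u*oneDrawℚ-linear (decay M) a (suc b) c total ⟩
    fromℕ (suc a) * (decay M * (u * fromℕ d))
      ≡⟨ cong (fromℕ (suc a) *_) (sym (decay-suc M)) ⟩
    fromℕ (suc a) * decay (suc M) ∎
    where open ≤-Reasoning

  error-bound : ∀ M a b c → a +ℕ b +ℕ c ≡ n → ∣ error M a b c ∣ ≤ fromℕ a * fromℕ (M +ℕ n) * decay M
  error-bound M zero b c _ =
    ∣≡0∣≤ (error-done M c (inj₁ refl)) (*-nonNeg (*-nonNeg (fromℕ-nonNeg 0) (fromℕ-nonNeg (M +ℕ n))) (decay-nonNeg M))
  error-bound M (suc a) zero c _ =
    ∣≡0∣≤ (error-done M c (inj₂ refl)) (*-nonNeg (*-nonNeg (fromℕ-nonNeg (suc a)) (fromℕ-nonNeg (M +ℕ n))) (decay-nonNeg M))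
  error-bound zero (suc a) (suc b) c _ = begin
    ∣ expectedStop (suc a) (suc b) - 0ℚ ∣
      ≡⟨ cong ∣_∣ (+-identityʳ (expectedStop (suc a) (suc b))) ⟩
    ∣ fromℕ n * harmonicGap (suc a) (suc b) ∣
      ≡⟨ 0≤p⇒∣p∣≡p (*-nonNeg (fromℕ-nonNeg n) (proj₁ (harmonicGap-bounds (suc a) (suc b)))) ⟩
    fromℕ n * harmonicGap (suc a) (suc b)
      ≤⟨ *-monoˡ-≤-0≤ (fromℕ-nonNeg n) (proj₂ (harmonicGap-bounds (suc a) (suc b))) ⟩
    fromℕ n * fromℕ (suc a)
      ≡⟨ solve 2 (λ N A → N :* A := A :* N :* con 1ℚ) refl (fromℕ n) (fromℕ (suc a)) ⟩
    fromℕ (suc a) * fromℕ n * 1ℚ ∎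
    where open ≤-Reasoning
  error-bound (suc M) (suc a) (suc b) c total = begin
    ∣ error (suc M) (suc a) (suc b) c ∣
      ≡⟨ cong ∣_∣ (error-suc M a b c total) ⟩
    ∣ u * oneDrawℚ (λ x y z → error M x y z + survival M x y z) (suc a) (suc b) c ∣
      ≤⟨ ∣r*p∣≤r*q u-nonNeg (∣oneDrawℚ∣≤ {λ x y z → error M x y z + survival M x y z} {λ x _ _ → fromℕ x * k}
           (suc a) (suc b) c
           (neighbour a (suc b) (suc c) (moveˡ {a} {suc b} total))
           (neighbour (suc a) b (suc c) (moveʳ {suc a} {b} total))
           (neighbour (suc a) (suc b) c total)) ⟩
    u * oneDrawℚ (λ x _ _ → fromℕ x * k) (suc a) (suc b) c
      ≡⟨ u*oneDrawℚ-linear k a (suc b) c total ⟩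
    fromℕ (suc a) * (k * (u * fromℕ d))
      ≡⟨ cong (fromℕ (suc a) *_) k*u*d≡ ⟩
    fromℕ (suc a) * (fromℕ (suc M +ℕ n) * decay (suc M))
      ≡⟨ sym (*-assoc (fromℕ (suc a)) _ _) ⟩
    fromℕ (suc a) * fromℕ (suc M +ℕ n) * decay (suc M) ∎
    where
    open ≤-Reasoning
    k = fromℕ (M +ℕ n) * decay M + decay M
    neighbour : ∀ x y z → x +ℕ y +ℕ z ≡ n → ∣ error M x y z + survival M x y z ∣ ≤ fromℕ x * k
    neighbour x y z t = subst (∣ error M x y z + survival M x y z ∣ ≤_)
      (solve 3 (λ X m ρ → X :* m :* ρ :+ X :* ρ := X :* (m :* ρ :+ ρ)) refl (fromℕ x) (fromℕ (M +ℕ n)) (decay M))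
      (∣p+q∣≤-+ (error-bound M x y z t) (survival-bound M x y z t))
    k*u*d≡ : k * (u * fromℕ d) ≡ fromℕ (suc M +ℕ n) * decay (suc M)
    k*u*d≡ = begin-equality
      (fromℕ (M +ℕ n) * decay M + decay M) * (u * fromℕ d)
        ≡⟨ solve 3 (λ m ρ q → (m :* ρ :+ ρ) :* q := (con 1ℚ :+ m) :* (ρ :* q)) refl (fromℕ (M +ℕ n)) (decay M) (u * fromℕ d) ⟩
      (1ℚ + fromℕ (M +ℕ n)) * (decay M * (u * fromℕ d))
        ≡⟨ cong₂ _*_ (sym (fromℕ-+ 1 (M +ℕ n))) (sym (decay-suc M)) ⟩
      fromℕ (suc M +ℕ n) * decay (suc M) ∎


  error-bound-frac : ∀ M a b c → a +ℕ b +ℕ c ≡ n →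
    ∣ error M a b c ∣ ≤ _/_ (+ (a *ℕ ((M +ℕ n) *ℕ d ^ℕ M))) (n ^ℕ M) {{ℕ.m^n≢0 n M}}
  error-bound-frac M a b c total = subst (∣ error M a b c ∣ ≤_) as-frac (error-bound M a b c total)
    where
    as-frac : fromℕ a * fromℕ (M +ℕ n) * decay M ≡ _/_ (+ (a *ℕ ((M +ℕ n) *ℕ d ^ℕ M))) (n ^ℕ M) {{ℕ.m^n≢0 n M}}
    as-frac = trans (*-assoc (fromℕ a) _ _)
      (trans (cong (fromℕ a *_) (fromℕ-*-frac (M +ℕ n) (d ^ℕ M) (n ^ℕ M) {{ℕ.m^n≢0 n M}}))
             (fromℕ-*-frac a ((M +ℕ n) *ℕ d ^ℕ M) (n ^ℕ M) {{ℕ.m^n≢0 n M}}))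

  moment-converges : ∀ a b c → a +ℕ b +ℕ c ≡ n → ∀ ε → 0ℚ < ε →
    Σ ℕ λ N → ∀ M → M ≥ N → ∣ moment M a b c - expectedStop a b ∣ < ε
  moment-converges a b c total ε 0<ε = N , close
    where
    N = proj₁ (eventually-< d (↧ₙ ε))
    a≤n : a ≤ℕ n
    a≤n = subst (a ≤ℕ_) total (ℕ.≤-trans (ℕ.m≤m+n a b) (ℕ.m≤m+n (a +ℕ b) c))
    small : ∀ M → M ≥ N → a *ℕ ((M +ℕ n) *ℕ d ^ℕ M) *ℕ ↧ₙ ε <ℕ n ^ℕ M
    small M N≤M = ℕ.≤-<-trans
      (ℕ.*-monoˡ-≤ (↧ₙ ε) (ℕ.≤-trans (ℕ.*-monoˡ-≤ ((M +ℕ n) *ℕ d ^ℕ M) a≤n)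
                                      (ℕ.≤-reflexive (sym (ℕ.*-assoc n (M +ℕ n) (d ^ℕ M))))))
      (proj₂ (eventually-< d (↧ₙ ε)) M N≤M)
    close : ∀ M → M ≥ N → ∣ moment M a b c - expectedStop a b ∣ < ε
    close M N≤M = begin-strict
      ∣ moment M a b c - expectedStop a b ∣
        ≡⟨ ∣p-q∣≡∣q-p∣ (moment M a b c) (expectedStop a b) ⟩
      ∣ error M a b c ∣
        ≤⟨ error-bound-frac M a b c total ⟩
      _/_ (+ (a *ℕ ((M +ℕ n) *ℕ d ^ℕ M))) (n ^ℕ M) {{ℕ.m^n≢0 n M}}
        <⟨ frac<ε (a *ℕ ((M +ℕ n) *ℕ d ^ℕ M)) (n ^ℕ M) {{ℕ.m^n≢0 n M}} ε 0<ε (small M N≤M) ⟩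
      ε ∎
      where open ≤-Reasoning

expectationPartial≡moment : ∀ {ℓ k d} (enc : Encoder ℓ k (suc d)) (i : Fin k)
  (dec : ∀ J → Dec (IsRetrievalSet enc i J)) {A B : Subset (suc d)} →
  (∀ J → IsMinimalRetrievalSet enc i J ⇔ (J ≡ A ⊎ J ≡ B)) → A ∩ B ≡ ⊥ →
  ∀ M → expectationPartial enc i dec M ≡ Series.moment d M (# A) (# B) (settled A B ⊥)
expectationPartial≡moment {d = d} enc i dec minimal⇔ A∩B≡⊥ zero    = refl
expectationPartial≡moment {d = d} enc i dec minimal⇔ A∩B≡⊥ (suc M) =
  cong₂ (λ p c → p + fromℕ (suc M) * _/_ (+ c) (suc d ^ℕ suc M) {{ℕ.m^n≢0 (suc d) (suc M)}})
        (expectationPartial≡moment enc i dec minimal⇔ A∩B≡⊥ M)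
        (countStopsExactlyAt enc i dec minimal⇔ A∩B≡⊥ (suc M))

theorem7 : ∀ {ℓ k n : ℕ} → ℓ ≥ 1 → .{{_ : NonZero n}} →
    (enc : Encoder ℓ k n) → InjectiveCode enc → (i : Fin k) →
    (dec : ∀ J → Dec (IsRetrievalSet enc i J)) →
    (A B : Subset n) →
    (∀ J → IsMinimalRetrievalSet enc i J ⇔ (J ≡ A ⊎ J ≡ B)) →
    A ∩ B ≡ ⊥ →
    ∀ (ε : ℚ) → 0ℚ < ε → Σ ℕ λ N → ∀ (M : ℕ) → M ≥ N →
      ∣ expectationPartial enc i dec M
        - (+ n / 1) * (H (# A) + H (# B) - H (# A +ℕ # B)) ∣ < ε
theorem7 {n = zero} _ {{()}}
theorem7 {n = suc d} _ enc _ i dec A B minimal⇔ A∩B≡⊥ ε 0<ε =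
  let N , converges = moment-converges (# A) (# B) (settled A B ⊥) (initialProfile-total A B A∩B≡⊥) ε 0<ε
  in N , λ M N≤M → subst (λ t → ∣ t - expectedStop (# A) (# B) ∣ < ε)
                         (sym (expectationPartial≡moment enc i dec minimal⇔ A∩B≡⊥ M)) (converges M N≤M)
  where open Series d
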